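{- Let $k$ and $\ell$ be integers with $k\ge 7$, $\ell\ge 10^7k^6$, such that $k$ is the smallest integer greater than $2$ that does not divide $\ell$. Let $H$ be an oriented graph such that for any vertex $x$ and any other vertex $y$ of $H$ there is a directed path of length at most $64k$ from $x$ to $y$. Suppose $H$ contains a closed walk $W$ of length $a+b<k$ with $a$ edges going forwards and $b$ edges going backwards, where $a\neq b$ are nonnegative integers. Then $H$ contains a closed directed walk of length $\ell$.
   Context: An oriented graph is a directed graph obtained from a simple undirected graph by orienting each edge. A closed walk of length $m$ in $H$ is a sequence of vertices $v_0,v_1,\dots,v_m=v_0$ such that for each $i$ the vertices $v_{i-1},v_i$ are joined by an edge of $H$ (in either direction); the edge is said to go forwards if it is oriented from $v_{i-1}$ to $v_i$, and backwards otherwise. A closed directed walk is a closed walk all of whose edges go forwards. -}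

module Defs where

open import Data.Nat using (ℕ; zero; suc; _+_; _*_; _^_; _≤_; _<_)
open import Data.Nat.Divisibility using (_∣_)
open import Data.Fin using (Fin)
open import Data.List using (List; []; _∷_)
open import Data.List.Relation.Unary.Unique.Propositional using (Unique)
open import Data.Product using (Σ; ∃; _×_)
open import Relation.Nullary using (¬_)

record OrientedGraph (n : ℕ) : Set₁ where
  field
    Edge     : Fin n → Fin n → Set
    irrefl   : ∀ x → ¬ Edge x x
    oriented : ∀ x y → Edge x y → ¬ Edge y x

module _ {n : ℕ} (H : OrientedGraph n) where
  open OrientedGraph H

  data DWalk : Fin n → Fin n → ℕ → Set where
    []  : ∀ {x} → DWalk x x 0
    _∷_ : ∀ {x y z m} → Edge x y → DWalk y z m → DWalk x z (suc m)

  vertices : ∀ {x y m} → DWalk x y m → List (Fin n)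
  vertices {x} []       = x ∷ []
  vertices {x} (_ ∷ w)  = x ∷ vertices w

  DPath : Fin n → Fin n → ℕ → Set
  DPath x y m = Σ (DWalk x y m) (λ w → Unique (vertices w))

  data Walk : Fin n → Fin n → ℕ → ℕ → Set where
    []   : ∀ {x} → Walk x x 0 0
    fwd  : ∀ {x y z a b} → Edge x y → Walk y z a b → Walk x z (suc a) b
    bwd  : ∀ {x y z a b} → Edge y x → Walk y z a b → Walk x z a (suc b)

SmallestNonDivisorAbove2 : ℕ → ℕ → Set
SmallestNonDivisorAbove2 k ℓ = (2 < k) × ¬ (k ∣ ℓ) × (∀ j → 2 < j → j < k → j ∣ ℓ)

module Submission where

open import Defs
open import Data.Nat using (ℕ; zero; suc; _+_; _*_; _^_; _∸_; _≤_; _<_; z≤n; s≤s; NonZero; >-nonZero; >-nonZero⁻¹)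
open import Data.Nat.Properties
open import Data.Nat.Divisibility using (_∣_; divides; ∣-trans; 1∣_)
open import Data.Nat.DivMod using (_%_; _/_; m≡m%n+[m/n]*n; m%n<n)
open import Data.Nat.Tactic.RingSolver using (solve-∀)
open import Data.Fin using (Fin)
open import Data.Product using (Σ; ∃₂; _×_; _,_)
open import Relation.Nullary using (¬_; contradiction)
open import Relation.Nullary.Decidable using (toWitness)
open import Relation.Binary using (Tri; tri<; tri≈; tri>)
open import Relation.Binary.PropositionalEquality

-- Straightening every backward edge y → x of W by a directed path x ⇝ y of
-- length m ≤ 64k, and optionally going t times around the directed cycle
-- that path closes with the edge, turns W into closed directed walks of
-- every length (a − b) + C + eC, where C = P + b and P is the total length
-- of the paths. Since a − b < k divides ℓ and ℓ is large, ℓ is a positive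
-- combination of (a − b) + C and C. If a < b we first reverse W.

module Walks {n : ℕ} (H : OrientedGraph n) where
  open OrientedGraph H

  infixr 5 _++_
  _++_ : ∀ {x y z m p} → DWalk H x y m → DWalk H y z p → DWalk H x z (m + p)
  []      ++ w = w
  (e ∷ u) ++ w = e ∷ (u ++ w)

  repeat : ∀ {x m} t → DWalk H x x m → DWalk H x x (t * m)
  repeat zero    w = []
  repeat (suc t) w = w ++ repeat t w

  snoc-fwd : ∀ {x y z a b} → Walk H x y a b → Edge y z → Walk H x z (suc a) b
  snoc-fwd []        e = fwd e []
  snoc-fwd (fwd f w) e = fwd f (snoc-fwd w e)
  snoc-fwd (bwd f w) e = bwd f (snoc-fwd w e)

  snoc-bwd : ∀ {x y z a b} → Walk H x y a b → Edge z y → Walk H x z a (suc b)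
  snoc-bwd []        e = bwd e []
  snoc-bwd (fwd f w) e = fwd f (snoc-bwd w e)
  snoc-bwd (bwd f w) e = bwd f (snoc-bwd w e)

  reverse : ∀ {x z a b} → Walk H x z a b → Walk H z x b a
  reverse []        = []
  reverse (fwd e w) = snoc-bwd (reverse w) e
  reverse (bwd e w) = snoc-fwd (reverse w) e

  edge⇒≢ : ∀ {x y} → Edge x y → ¬ (x ≡ y)
  edge⇒≢ {x} e refl = irrefl x e

  detour : ∀ {x y m} → Edge y x → DWalk H x y m → ∀ t → DWalk H x y (t * (m + 1) + m)
  detour e π t = repeat t (π ++ e ∷ []) ++ π

  closed-combination : ∀ {v A C} → (∀ e → DWalk H v v (A + e * C)) →
    ∀ U E → DWalk H v v (suc U * A + E * C)
  closed-combination {A = A} {C} f U E =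
    subst (DWalk H _ _) (length-identity U A E C) (repeat U (f 0) ++ f E)
    where
    length-identity : ∀ U A E C → U * (A + 0 * C) + (A + E * C) ≡ suc U * A + E * C
    length-identity = solve-∀

  module _ (K : ℕ)
    (connected : ∀ (x y : Fin n) → ¬ (x ≡ y) → Σ ℕ (λ m → (m ≤ K) × DPath H x y m)) where

    walk⇒dwalks : ∀ {x z a b} → Walk H x z a b →
      Σ ℕ (λ P → (P ≤ K * b) × (∀ e → DWalk H x z (a + P + e * (P + b))))
    walk⇒dwalks [] = 0 , z≤n , λ e → subst (DWalk H _ _) (sym (*-zeroʳ e)) []
    walk⇒dwalks (fwd e w) with walk⇒dwalks w
    ... | P , P≤ , f = P , P≤ , λ t → e ∷ f t
    walk⇒dwalks {x} {a = a} {suc b} (bwd {y = y} e w)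
      with walk⇒dwalks w | connected x y (≢-sym (edge⇒≢ e))
    ... | P , P≤ , f | m , m≤K , (π , _) =
      m + P , subst (m + P ≤_) (sym (*-suc K b)) (+-mono-≤ m≤K P≤) ,
      λ t → subst (DWalk H _ _) (length-identity t m a P b) (detour e π t ++ f t)
      where
      length-identity : ∀ t m a P b →
        t * (m + 1) + m + (a + P + t * (P + b)) ≡ a + (m + P) + t * ((m + P) + suc b)
      length-identity = solve-∀

-- Writing L = r + qM with M = D + C, one has
-- D·L = (r + qD − C)·M + (M − r)·C, and q > C makes the first coefficient positive.
multiple-as-combination : ∀ d C ℓ → suc d ∣ ℓ → suc d * (suc C * (suc d + C)) ≤ ℓ →
  ∃₂ λ U E → ℓ ≡ suc U * (suc d + C) + E * C
multiple-as-combination d C ℓ (divides L ℓ≡L*D) ℓ-large =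
  U , E , +-cancelʳ-≡ (r * C) _ _ ℓ+rC≡
  where
  M = suc d + C
  r = L % M
  q = L / M

  L≡r+qM : L ≡ r + q * M
  L≡r+qM = m≡m%n+[m/n]*n L M

  C<q : C < q
  C<q = ≤-pred (*-cancelʳ-< M (suc C) (suc q) (begin-strict
    suc C * M         ≤⟨ *-cancelˡ-≤ (suc d) (subst (suc d * (suc C * M) ≤_) (trans ℓ≡L*D (*-comm L (suc d))) ℓ-large) ⟩
    L                 ≡⟨ L≡r+qM ⟩
    r + q * M         <⟨ +-monoˡ-< (q * M) (m%n<n L M) ⟩
    suc q * M         ∎))
    where open ≤-Reasoning

  q' = q ∸ suc C
  E = M ∸ r
  U = r + d + suc d * q' + C * d

  r+E≡M : r + E ≡ M
  r+E≡M = m+[n∸m]≡n (<⇒≤ (m%n<n L M))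

  L≡r+[C+1+q']M : L ≡ r + (suc C + q') * M
  L≡r+[C+1+q']M = trans L≡r+qM (cong (λ s → r + s * M) (sym (m+[n∸m]≡n C<q)))

  ring-identity : ∀ d C r q' →
    (r + (suc C + q') * (suc d + C)) * suc d + r * C
      ≡ suc (r + d + suc d * q' + C * d) * (suc d + C) + (suc d + C) * C
  ring-identity = solve-∀

  regroup : ∀ x y z w → x + (y + z) * w ≡ (x + z * w) + y * w
  regroup = solve-∀

  ℓ+rC≡ : ℓ + r * C ≡ (suc U * M + E * C) + r * C
  ℓ+rC≡ = begin
    ℓ + r * C                               ≡⟨ cong (_+ r * C) (trans ℓ≡L*D (cong (_* suc d) L≡r+[C+1+q']M)) ⟩
    (r + (suc C + q') * M) * suc d + r * C  ≡⟨ ring-identity d C r q' ⟩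
    suc U * M + M * C                       ≡⟨ cong (λ s → suc U * M + s * C) (sym r+E≡M) ⟩
    suc U * M + (r + E) * C                 ≡⟨ regroup (suc U * M) r E C ⟩
    (suc U * M + E * C) + r * C             ∎
    where open ≡-Reasoning

divides-below-smallestNonDivisor : ∀ {k ℓ} → 4 < k → SmallestNonDivisorAbove2 k ℓ →
  ∀ {j} → 0 < j → j < k → j ∣ ℓ
divides-below-smallestNonDivisor _   _              {1}                   _ _   = 1∣ _
divides-below-smallestNonDivisor 4<k (_ , _ , below) {2}                   _ _   =
  ∣-trans (divides 2 refl) (below 4 (s≤s (s≤s (s≤s z≤n))) 4<k)
divides-below-smallestNonDivisor _   (_ , _ , below) {suc (suc (suc j))}   _ j<k =
  below _ (s≤s (s≤s (s≤s z≤n))) j<k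

detour-total-bound : ∀ {k b P} .{{_ : NonZero k}} → b ≤ k → P ≤ 64 * k * b → P + b ≤ 65 * (k * k)
detour-total-bound {k} {b} {P} b≤k P≤ = begin
  P + b              ≤⟨ +-mono-≤ (≤-trans P≤ (*-monoʳ-≤ (64 * k) b≤k)) (≤-trans b≤k (m≤m*n k k)) ⟩
  64 * k * k + k * k ≡⟨ collect k ⟩
  65 * (k * k)       ∎
  where
  open ≤-Reasoning
  collect : ∀ k → 64 * k * k + k * k ≡ 65 * (k * k)
  collect = solve-∀

length-bound : ∀ k D C .{{_ : NonZero k}} → D ≤ k → C ≤ 65 * (k * k) →
  D * (suc C * (D + C)) ≤ 10 ^ 7 * k ^ 6
length-bound k D C D≤k C≤ = begin
  D * (suc C * (D + C))                ≤⟨ *-mono-≤ D≤k (*-mono-≤ (+-mono-≤ 1≤kk C≤) (+-mono-≤ (≤-trans D≤k k≤kk) C≤)) ⟩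
  k * (66 * (k * k) * (66 * (k * k)))  ≡⟨ power-identity k ⟩
  4356 * k ^ 5                         ≤⟨ *-monoˡ-≤ (k ^ 5) (toWitness {a? = 4356 ≤? 10 ^ 7} _) ⟩
  10 ^ 7 * k ^ 5                       ≤⟨ *-monoʳ-≤ (10 ^ 7) (m≤n*m (k ^ 5) k) ⟩
  10 ^ 7 * k ^ 6                       ∎
  where
  open ≤-Reasoning
  k≤kk : k ≤ k * k
  k≤kk = m≤m*n k k
  1≤kk : 1 ≤ k * k
  1≤kk = ≤-trans (>-nonZero⁻¹ k) k≤kk
  -- k ^ 5 written out: the ring solver does not accept _^_ here
  power-identity : ∀ k → k * (66 * (k * k) * (66 * (k * k))) ≡ 4356 * (k * (k * (k * (k * (k * 1)))))
  power-identity = solve-∀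

-- Local functions rather than `with` below: with-abstraction over a context
-- containing ℓ-large would unfold the literal 10 ^ 7 in 10 ^ 7 * k ^ 6.
module _ {k ℓ : ℕ} (7≤k : 7 ≤ k) (ℓ-large : 10 ^ 7 * k ^ 6 ≤ ℓ)
  (smallest : SmallestNonDivisorAbove2 k ℓ) {n : ℕ} (H : OrientedGraph n)
  (connected : ∀ (x y : Fin n) → ¬ (x ≡ y) → Σ ℕ (λ m → (m ≤ 64 * k) × DPath H x y m)) where
  open Walks H

  instance
    k-nonZero : NonZero k
    k-nonZero = >-nonZero (≤-trans (s≤s z≤n) 7≤k)

  closedDWalk-of-lengths : ∀ {v} d C → suc d < k → C ≤ 65 * (k * k) →
    (∀ e → DWalk H v v (suc d + C + e * C)) → DWalk H v v ℓ
  closedDWalk-of-lengths {v} d C d<k C≤ dwalks =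
    realise (multiple-as-combination d C ℓ
      (divides-below-smallestNonDivisor (≤-trans (m≤m+n 5 2) 7≤k) smallest (s≤s z≤n) d<k)
      (≤-trans (length-bound k (suc d) C (<⇒≤ d<k) C≤) ℓ-large))
    where
    realise : ∃₂ (λ U E → ℓ ≡ suc U * (suc d + C) + E * C) → DWalk H v v ℓ
    realise (U , E , ℓ≡) = subst (DWalk H _ _) (sym ℓ≡) (closed-combination dwalks U E)

  closedDWalk-of-unbalanced : ∀ {v a b} → b < a → a + b < k → Walk H v v a b → DWalk H v v ℓ
  closedDWalk-of-unbalanced {v} {a} {b} b<a a+b<k w = from-dwalks (walk⇒dwalks (64 * k) connected w)
    where
    d = a ∸ suc b
    a≡ : a ≡ suc d + b
    a≡ = trans (sym (m∸n+n≡m b<a)) (+-suc d b)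
    d<k : suc d < k
    d<k = ≤-<-trans (subst (suc d ≤_) (sym a≡) (m≤m+n (suc d) b)) (≤-<-trans (m≤m+n a b) a+b<k)
    b≤k : b ≤ k
    b≤k = <⇒≤ (≤-<-trans (m≤n+m b a) a+b<k)
    from-dwalks : Σ ℕ (λ P → (P ≤ 64 * k * b) × (∀ e → DWalk H v v (a + P + e * (P + b)))) → DWalk H v v ℓ
    from-dwalks (P , P≤ , dwalks) =
      closedDWalk-of-lengths d (P + b) d<k (detour-total-bound b≤k P≤)
        (λ e → subst (DWalk H v v) (cong (_+ e * (P + b)) a+P≡) (dwalks e))
      where
      a+P≡ : a + P ≡ suc d + (P + b)
      a+P≡ = trans (cong (_+ P) a≡) (trans (+-assoc (suc d) b P) (cong (suc d +_) (+-comm b P)))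

lemma2p6 : (k ℓ : ℕ) → 7 ≤ k → (10 ^ 7) * (k ^ 6) ≤ ℓ → SmallestNonDivisorAbove2 k ℓ →
    (n : ℕ) (H : OrientedGraph n) →
    (∀ (x y : Fin n) → ¬ (x ≡ y) → Σ ℕ (λ m → (m ≤ 64 * k) × DPath H x y m)) →
    (v : Fin n) (a b : ℕ) → ¬ (a ≡ b) → a + b < k → Walk H v v a b →
    Σ (Fin n) (λ x → DWalk H x x ℓ)
lemma2p6 k ℓ 7≤k ℓ-large smallest n H connected v a b a≢b a+b<k w = v , by-cases (<-cmp a b)
  where
  unbalanced : ∀ {a b} → b < a → a + b < k → Walk H v v a b → DWalk H v v ℓ
  unbalanced = closedDWalk-of-unbalanced 7≤k ℓ-large smallest H connected
  by-cases : Tri (a < b) (a ≡ b) (b < a) → DWalk H v v ℓ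
  by-cases (tri< a<b _ _) = unbalanced a<b (subst (_< k) (+-comm a b) a+b<k) (Walks.reverse H w)
  by-cases (tri≈ _ a≡b _) = contradiction a≡b a≢b
  by-cases (tri> _ _ b<a) = unbalanced b<a a+b<k w
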